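{- Let $\mathcal{B}=(\mathcal{V},\mathcal{E})$ be a finite connected undirected graph with an action of a group $G$ by graph automorphisms, and let $\mathcal{W}$ be the set of $G$-pivot vertices of $\mathcal{B}$. Let $v\in\mathcal{V}$. Then $|\mathcal{W}\setminus Gv|\leq \beta(\mathcal{B})+|Gv|-1$.
   Context: A finite undirected graph $\mathcal{B}$ has a finite vertex set $\mathcal{V}$ and an edge set $\mathcal{E}$ of $2$-element subsets of $\mathcal{V}$. A vertex $v$ is a $G$-pivot vertex if for every $w\in\mathcal{V}$ with $\{v,w\}\in\mathcal{E}$, the set $\{gw\mid g\in G,\ gv=v\}$ has even cardinality. $Gv$ denotes the $G$-orbit of $v$. The Betti number is $\beta(\mathcal{B})=|\mathcal{E}|-|\mathcal{V}|+1$. -}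

module Defs where

open import Level using (Level; _⊔_)
open import Data.Bool using (Bool; true; false; T; T?)
open import Data.Nat using (ℕ; _<?_)
open import Data.Nat.Divisibility using (_∣_)
open import Data.Integer as ℤ using (ℤ; +_)
open import Data.Fin using (Fin; toℕ)
open import Data.Fin.Subset using (Subset; _∈_; ∣_∣)
open import Data.List using (List; length; filter; cartesianProduct; allFin)
open import Data.Product using (_×_; _,_; Σ; ∃)
open import Relation.Nullary.Decidable using (_×-dec_)
open import Relation.Binary.PropositionalEquality using (_≡_)
open import Function.Bundles using (_⇔_)
open import Algebra.Bundles using (Group)

record Graph (n : ℕ) : Set where
  field
    adj   : Fin n → Fin n → Bool
    sym   : ∀ x y → adj x y ≡ adj y x
    irrefl : ∀ x → adj x x ≡ false

open Graph public

Adj : ∀ {n} → Graph n → Fin n → Fin n → Set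
Adj B x y = T (adj B x y)

-- Edge set: unordered pairs {x,y} represented by ordered pairs with x < y.
edgeList : ∀ {n} → Graph n → List (Fin n × Fin n)
edgeList {n} B =
  filter (λ p → (toℕ (Data.Product.proj₁ p) <? toℕ (Data.Product.proj₂ p))
                  ×-dec T? (adj B (Data.Product.proj₁ p) (Data.Product.proj₂ p)))
         (cartesianProduct (allFin n) (allFin n))

numEdges : ∀ {n} → Graph n → ℕ
numEdges B = length (edgeList B)

betti : ∀ {n} → Graph n → ℤ
betti {n} B = (+ numEdges B ℤ.- + n) ℤ.+ + 1

data Reach {n} (B : Graph n) : Fin n → Fin n → Set where
  here : ∀ {x} → Reach B x x
  step : ∀ {x y z} → Adj B x y → Reach B y z → Reach B x z

Connected : ∀ {n} → Graph n → Set
Connected {n} B = ∀ (x y : Fin n) → Reach B x y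

record Action {c ℓ} (G : Group c ℓ) {n} (B : Graph n) : Set (c ⊔ ℓ) where
  open Group G
  field
    act      : Carrier → Fin n → Fin n
    act-ε    : ∀ x → act ε x ≡ x
    act-∙    : ∀ g h x → act (g ∙ h) x ≡ act g (act h x)
    act-cong : ∀ {g h} → g ≈ h → ∀ x → act g x ≡ act h x
    act-adj  : ∀ g x y → adj B (act g x) (act g y) ≡ adj B x y

open Action public

-- "S represents the set {x | P x}" : S is the subset of Fin n with exactly
-- the elements satisfying P.  Cardinality of a set = ∣ S ∣ for its representing subset.
Represents : ∀ {a n} → Subset n → (Fin n → Set a) → Set a
Represents {n = n} S P = ∀ (x : Fin n) → (x ∈ S) ⇔ P x

module _ {c ℓ} {G : Group c ℓ} {n} {B : Graph n} (α : Action G B) where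
  open Group G

  InOrbit : Fin n → Fin n → Set c
  InOrbit v x = ∃ λ g → act α g v ≡ x

  StabOrbit : Fin n → Fin n → Fin n → Set c
  StabOrbit v w x = ∃ λ g → (act α g v ≡ v) × (act α g w ≡ x)

  Pivot : Fin n → Set c
  Pivot v = ∀ (w : Fin n) → Adj B v w →
            ∀ (S : Subset n) → Represents S (StabOrbit v w) → 2 ∣ ∣ S ∣

module Submission where

-- Let W be the set of pivots outside the orbit Gv.  Since B is
-- connected, every vertex x has a distance h x to Gv, and every x ∉ Gv
-- has a neighbour u with h u < h x.  As G permutes Gv and acts by
-- graph automorphisms, h is G-invariant.  Call u a lower neighbour of x if u ~ x and h u < h x,
-- and let down x be the number of lower neighbours of x.
--   * An edge is a lower-neighbour pair for at most one of its ends,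
--     so  Σ_x down x ≤ |E|.
--   * If x ∉ Gv is a pivot and u is a lower neighbour of x, then every
--     gu with gx = x is again a lower neighbour; as {gu | gx = x} has
--     even size it is not {u}, hence down x ≥ 2.
-- So [x ∈ W] + 1 ≤ down x + [x ∈ Gv] for every vertex x, and summing
-- over x gives |W| + |V| ≤ |E| + |Gv|, i.e. |W| ≤ β(B) + |Gv| - 1.

open import Defs hiding (sym)
open import Data.Nat using (ℕ)
open import Data.Fin using (Fin)
open import Data.Fin.Subset using (Subset; ∣_∣)
open import Data.Integer using (+_; _+_; _-_; _≤_)
open import Data.Product using (_×_)
open import Relation.Nullary using (¬_)
open import Algebra.Bundles using (Group)

open import Data.Nat
  using (zero; suc; z≤n; s≤s; _<_; _<?_; _≤?_)
  renaming (_+_ to _⊕_; _≤_ to _≤ₙ_)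
import Data.Nat.Properties as ℕP
open import Data.Nat.Divisibility using (_∣_; ∣1⇒≡1)
import Data.Integer as ℤ
import Data.Integer.Properties as ℤP
open import Data.Integer.Tactic.RingSolver using (solve-∀)
open import Data.Bool using (if_then_else_; T)
open import Data.Fin using (zero; suc; toℕ; _≟_)
import Data.Fin.Properties as FinP
open import Data.Fin.Subset using (_∈_; _∉_; ⁅_⁆; inside; outside)
open import Data.Fin.Subset.Properties using (_∈?_; x∈⁅y⁆⇒x≡y; x∈⁅x⁆; ∣⁅x⁆∣≡1)
open import Data.List using (length; _++_; filter; tabulate; map; cartesianProduct)
import Data.List.Properties as ListP
open import Data.Vec using (_∷_; [])
open import Data.Product using (_,_; ∃; proj₁; proj₂)
open import Data.Sum using (_⊎_; inj₁; inj₂)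
open import Function using (_∘_; _⇔_; mk⇔; Equivalence)
open import Relation.Nullary using (Dec; yes; no; does; contradiction)
open import Relation.Nullary.Decidable using (_×-dec_; _⊎-dec_; ¬?; T?)
open import Relation.Unary using (Pred; Decidable)
open import Relation.Binary using (tri<; tri≈; tri>)
open import Relation.Binary.PropositionalEquality
  using (_≡_; _≢_; refl; sym; trans; cong; cong₂; subst; subst₂; module ≡-Reasoning)
open import Algebra.Properties.CommutativeMonoid.Sum ℕP.+-0-commutativeMonoid
  using (sum; sum-syntax; ∑-distrib-+; ∑-comm; sum-cong-≗)

𝟙 : ∀ {p} {P : Set p} → Dec P → ℕ
𝟙 d = if does d then 1 else 0

𝟙-yes : ∀ {p} {P : Set p} (d : Dec P) → P → 𝟙 d ≡ 1
𝟙-yes (yes _) _  = refl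
𝟙-yes (no ¬p) p = contradiction p ¬p

𝟙-cong : ∀ {p q} {P : Set p} {Q : Set q} → P ⇔ Q → (d : Dec P) (e : Dec Q) → 𝟙 d ≡ 𝟙 e
𝟙-cong P⇔Q (yes _) (yes _)  = refl
𝟙-cong P⇔Q (yes p) (no ¬q)  = contradiction (Equivalence.to P⇔Q p) ¬q
𝟙-cong P⇔Q (no ¬p) (yes q)  = contradiction (Equivalence.from P⇔Q q) ¬p
𝟙-cong P⇔Q (no _)  (no _)   = refl

∑-mono : ∀ {n} {f g : Fin n → ℕ} → (∀ i → f i ≤ₙ g i) → sum f ≤ₙ sum g
∑-mono {zero}  f≤g = z≤n
∑-mono {suc n} f≤g = ℕP.+-mono-≤ (f≤g zero) (∑-mono (f≤g ∘ suc))

term≤∑ : ∀ {n} (f : Fin n → ℕ) i → f i ≤ₙ sum f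
term≤∑ f zero    = ℕP.m≤m+n _ _
term≤∑ f (suc i) = ℕP.≤-trans (term≤∑ (f ∘ suc) i) (ℕP.m≤n+m _ (f zero))

twoTerms≤∑ : ∀ {n} (f : Fin n → ℕ) {i j} → i ≢ j → f i ⊕ f j ≤ₙ sum f
twoTerms≤∑ f {zero}  {zero}  i≢j = contradiction refl i≢j
twoTerms≤∑ f {zero}  {suc j} i≢j = ℕP.+-monoʳ-≤ (f zero) (term≤∑ (f ∘ suc) j)
twoTerms≤∑ f {suc i} {zero}  i≢j =
  subst (_≤ₙ sum f) (ℕP.+-comm (f zero) (f (suc i))) (ℕP.+-monoʳ-≤ (f zero) (term≤∑ (f ∘ suc) i))
twoTerms≤∑ f {suc i} {suc j} i≢j =
  ℕP.≤-trans (twoTerms≤∑ (f ∘ suc) (i≢j ∘ cong suc)) (ℕP.m≤n+m _ (f zero))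

∑-ones : ∀ n → ∑[ i < n ] 1 ≡ n
∑-ones zero    = refl
∑-ones (suc n) = cong suc (∑-ones n)

∑∑-symmetrise : ∀ {n} (f : Fin n → Fin n → ℕ) →
  ∑[ x < n ] ∑[ y < n ] (f x y ⊕ f y x) ≡ ∑[ x < n ] ∑[ y < n ] f x y ⊕ ∑[ x < n ] ∑[ y < n ] f x y
∑∑-symmetrise {n} f = begin
  ∑[ x < n ] ∑[ y < n ] (f x y ⊕ f y x)                        ≡⟨ sum-cong-≗ (λ x → ∑-distrib-+ (f x) (λ y → f y x)) ⟩
  ∑[ x < n ] (∑[ y < n ] f x y ⊕ ∑[ y < n ] f y x)              ≡⟨ ∑-distrib-+ (λ x → sum (f x)) (λ x → ∑[ y < n ] f y x) ⟩
  ∑[ x < n ] ∑[ y < n ] f x y ⊕ ∑[ x < n ] ∑[ y < n ] f y x     ≡⟨ cong (∑[ x < n ] ∑[ y < n ] f x y ⊕_) (sym (∑-comm f)) ⟩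
  ∑[ x < n ] ∑[ y < n ] f x y ⊕ ∑[ x < n ] ∑[ y < n ] f x y     ∎
  where open ≡-Reasoning

half-≤ : ∀ a b → a ⊕ a ≤ₙ b ⊕ b → a ≤ₙ b
half-≤ a b 2a≤2b with a ≤? b
... | yes a≤b = a≤b
... | no  a≰b = contradiction 2a≤2b (ℕP.<⇒≱ (ℕP.+-mono-< (ℕP.≰⇒> a≰b) (ℕP.≰⇒> a≰b)))

∣S∣≡∑ : ∀ {n} (S : Subset n) → ∣ S ∣ ≡ ∑[ x < n ] 𝟙 (x ∈? S)
∣S∣≡∑ []            = refl
∣S∣≡∑ (inside ∷ S)  = cong suc (∣S∣≡∑ S)
∣S∣≡∑ (outside ∷ S) = ∣S∣≡∑ S

module _ {a p} {A : Set a} {P : Pred A p} (P? : Decidable P) where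

  length-filter-tabulate : ∀ {n} (f : Fin n → A) →
    length (filter P? (tabulate f)) ≡ ∑[ i < n ] 𝟙 (P? (f i))
  length-filter-tabulate {zero}  f = refl
  length-filter-tabulate {suc n} f with P? (f zero)
  ... | yes _ = cong suc (length-filter-tabulate (f ∘ suc))
  ... | no  _ = length-filter-tabulate (f ∘ suc)

module _ {a b p} {A : Set a} {B : Set b} {P : Pred (A × B) p} (P? : Decidable P) where

  length-filter-product : ∀ {m n} (f : Fin m → A) (g : Fin n → B) →
    length (filter P? (cartesianProduct (tabulate f) (tabulate g)))
      ≡ ∑[ i < m ] ∑[ j < n ] 𝟙 (P? (f i , g j))
  length-filter-product {zero}  f g = refl
  length-filter-product {suc m} f g = begin
    length (filter P? (map (f zero ,_) (tabulate g) ++ rest))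
      ≡⟨ cong length (ListP.filter-++ P? (map (f zero ,_) (tabulate g)) rest) ⟩
    length (filter P? (map (f zero ,_) (tabulate g)) ++ filter P? rest)
      ≡⟨ ListP.length-++ (filter P? (map (f zero ,_) (tabulate g))) ⟩
    length (filter P? (map (f zero ,_) (tabulate g))) ⊕ length (filter P? rest)
      ≡⟨ cong₂ _⊕_ firstRow (length-filter-product (f ∘ suc) g) ⟩
    ∑[ j < _ ] 𝟙 (P? (f zero , g j)) ⊕ ∑[ i < m ] ∑[ j < _ ] 𝟙 (P? (f (suc i) , g j))
      ∎
    where
    open ≡-Reasoning
    rest = cartesianProduct (tabulate (f ∘ suc)) (tabulate g)
    firstRow : length (filter P? (map (f zero ,_) (tabulate g))) ≡ ∑[ j < _ ] 𝟙 (P? (f zero , g j))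
    firstRow = trans (cong (length ∘ filter P?) (ListP.map-tabulate g (f zero ,_)))
                     (length-filter-tabulate P? (λ j → f zero , g j))

module Edges {n} (B : Graph n) where

  edge? : (p : Fin n × Fin n) → Dec (toℕ (proj₁ p) < toℕ (proj₂ p) × Adj B (proj₁ p) (proj₂ p))
  edge? p = (toℕ (proj₁ p) <? toℕ (proj₂ p)) ×-dec T? (adj B (proj₁ p) (proj₂ p))

  numEdges≡∑∑ : numEdges B ≡ ∑[ x < n ] ∑[ y < n ] 𝟙 (edge? (x , y))
  numEdges≡∑∑ = length-filter-product edge? (λ x → x) (λ y → y)

  adj⇒≢ : ∀ {x y} → Adj B x y → x ≢ y
  adj⇒≢ {x} x~y refl = subst T (irrefl B x) x~y

  edge-counted : ∀ {x y} → Adj B x y → 1 ≤ₙ 𝟙 (edge? (x , y)) ⊕ 𝟙 (edge? (y , x))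
  edge-counted {x} {y} x~y with ℕP.<-cmp (toℕ x) (toℕ y)
  ... | tri< x<y _ _ = subst (_≤ₙ 𝟙 (edge? (x , y)) ⊕ 𝟙 (edge? (y , x)))
                             (𝟙-yes (edge? (x , y)) (x<y , x~y)) (ℕP.m≤m+n _ _)
  ... | tri≈ _ x≡y _ = contradiction (FinP.toℕ-injective x≡y) (adj⇒≢ x~y)
  ... | tri> _ _ y<x = subst (_≤ₙ 𝟙 (edge? (x , y)) ⊕ 𝟙 (edge? (y , x)))
                             (𝟙-yes (edge? (y , x)) (y<x , y~x)) (ℕP.m≤n+m _ _)
    where
    y~x : Adj B y x
    y~x = subst T (Graph.sym B x y) x~y

  module _ (h : Fin n → ℕ) where

    Lower : Fin n → Fin n → Set
    Lower x u = Adj B x u × h u < h x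

    lower? : ∀ x u → Dec (Lower x u)
    lower? x u = T? (adj B x u) ×-dec (h u <? h x)

    down : Fin n → ℕ
    down x = ∑[ u < n ] 𝟙 (lower? x u)

    lowerPair≤edgePair : ∀ x u → 𝟙 (lower? x u) ⊕ 𝟙 (lower? u x) ≤ₙ 𝟙 (edge? (x , u)) ⊕ 𝟙 (edge? (u , x))
    lowerPair≤edgePair x u = bound (lower? x u) (lower? u x)
      where
      bound : (xu? : Dec (Lower x u)) (ux? : Dec (Lower u x)) →
              𝟙 xu? ⊕ 𝟙 ux? ≤ₙ 𝟙 (edge? (x , u)) ⊕ 𝟙 (edge? (u , x))
      bound (yes (_ , u<x)) (yes (_ , x<u)) = contradiction x<u (ℕP.<-asym u<x)
      bound (yes (x~u , _)) (no _)          = edge-counted x~u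
      bound (no _)          (yes (u~x , _)) =
        subst (1 ≤ₙ_) (ℕP.+-comm (𝟙 (edge? (u , x))) _) (edge-counted u~x)
      bound (no _)          (no _)          = z≤n

    -- Every edge is a lower-neighbour pair at most once.
    ∑down≤numEdges : ∑[ x < n ] down x ≤ₙ numEdges B
    ∑down≤numEdges = subst (∑[ x < n ] down x ≤ₙ_) (sym numEdges≡∑∑) (half-≤ _ _
      (subst₂ _≤ₙ_ (∑∑-symmetrise (λ x u → 𝟙 (lower? x u))) (∑∑-symmetrise (λ x u → 𝟙 (edge? (x , u))))
        (∑-mono λ x → ∑-mono λ u → lowerPair≤edgePair x u)))

misses : ∀ {p} {P : ℕ → Set p} → (∀ k → Dec (P k)) → ℕ → ℕ
misses P? zero    = 0
misses P? (suc N) = 𝟙 (¬? (P? N)) ⊕ misses P? N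

misses-cong : ∀ {p q} {P : ℕ → Set p} {Q : ℕ → Set q}
  (P? : ∀ k → Dec (P k)) (Q? : ∀ k → Dec (Q k)) → (∀ k → P k ⇔ Q k) →
  ∀ N → misses P? N ≡ misses Q? N
misses-cong P? Q? P⇔Q zero    = refl
misses-cong P? Q? P⇔Q (suc N) = cong₂ _⊕_
  (𝟙-cong (mk⇔ (λ ¬p q → ¬p (Equivalence.from (P⇔Q N) q)) (λ ¬q p → ¬q (Equivalence.to (P⇔Q N) p)))
          (¬? (P? N)) (¬? (Q? N)))
  (misses-cong P? Q? P⇔Q N)

misses≤ : ∀ {p} {P : ℕ → Set p} (P? : ∀ k → Dec (P k)) N → misses P? N ≤ₙ N
misses≤ P? zero    = z≤n
misses≤ P? (suc N) with P? N
... | yes _ = ℕP.m≤n⇒m≤1+n (misses≤ P? N)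
... | no  _ = s≤s (misses≤ P? N)

-- A decidable sequence that, once true, stays true; misses P? N is then
-- the first index at which P holds (when P N holds).
module Monotone {p} {P : ℕ → Set p} (P? : ∀ k → Dec (P k))
                (P-step : ∀ {k} → P k → P (suc k)) where

  P-mono : ∀ {k m} → k ≤ₙ m → P k → P m
  P-mono {k} {m} k≤m Pk with ℕP.m≤n⇒∃[o]m+o≡n k≤m
  ... | o , refl = climb o
    where
    climb : ∀ o → P (k ⊕ o)
    climb zero    = subst P (sym (ℕP.+-identityʳ k)) Pk
    climb (suc o) = subst P (sym (ℕP.+-suc k o)) (P-step (climb o))

  misses-all : ∀ {N} → ¬ P N → misses P? N ≡ N
  misses-all {zero}  _    = refl
  misses-all {suc N} ¬PsN with P? N
  ... | yes PN = contradiction (P-step PN) ¬PsN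
  ... | no ¬PN = cong suc (misses-all ¬PN)

  misses≤hit : ∀ {k} → P k → ∀ N → misses P? N ≤ₙ k
  misses≤hit Pk zero    = z≤n
  misses≤hit {k} Pk (suc N) with P? N
  ... | yes _  = misses≤hit Pk N
  ... | no ¬PN = ℕP.<-≤-trans (s≤s (misses≤ P? N)) (ℕP.≰⇒> (λ k≤N → ¬PN (P-mono k≤N Pk)))

  miss<misses : ∀ {k N} → ¬ P k → P N → k < misses P? N
  miss<misses {k} {zero}  ¬Pk P0 = contradiction (P-mono z≤n P0) ¬Pk
  miss<misses {k} {suc N} ¬Pk PsN with P? N
  ... | yes PN = miss<misses ¬Pk PN
  ... | no ¬PN = s≤s (subst (k ≤ₙ_) (sym (misses-all ¬PN))
                   (ℕP.≮⇒≥ (λ N<k → ¬Pk (P-mono N<k PsN))))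

  switch : ∀ {N} → ¬ P 0 → P N → ∃ λ j → ¬ P j × P (suc j)
  switch {zero}  ¬P0 P0  = contradiction P0 ¬P0
  switch {suc N} ¬P0 PsN with P? N
  ... | yes PN = switch ¬P0 PN
  ... | no ¬PN = N , ¬PN , PsN

walkLength : ∀ {n} {B : Graph n} {x y} → Reach B x y → ℕ
walkLength here       = 0
walkLength (step _ r) = suc (walkLength r)

module Distance {n} (B : Graph n) (S : Subset n) where

  Near : ℕ → Fin n → Set
  Near zero    x = x ∈ S
  Near (suc k) x = Near k x ⊎ ∃ λ u → Adj B x u × Near k u

  near? : ∀ k x → Dec (Near k x)
  near? zero    x = x ∈? S
  near? (suc k) x = near? k x ⊎-dec FinP.any? (λ u → T? (adj B x u) ×-dec near? k u)

  walk-near : ∀ {x y} (r : Reach B x y) → y ∈ S → Near (walkLength r) x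
  walk-near here         y∈S = y∈S
  walk-near (step x~u r) y∈S = inj₂ (_ , x~u , walk-near r y∈S)

  record Symmetry (σ : Fin n → Fin n) : Set where
    field
      σ-adj : ∀ {x y} → Adj B x y → Adj B (σ x) (σ y)
      σ-S   : ∀ {x} → x ∈ S → σ x ∈ S

  near-transport : ∀ {σ} → Symmetry σ → ∀ k {x} → Near k x → Near k (σ x)
  near-transport sym-σ zero    x∈S                 = Symmetry.σ-S sym-σ x∈S
  near-transport sym-σ (suc k) (inj₁ near)         = inj₁ (near-transport sym-σ k near)
  near-transport sym-σ (suc k) (inj₂ (u , x~u , near)) =
    inj₂ (_ , Symmetry.σ-adj sym-σ x~u , near-transport sym-σ k near)

  module _ (conn : Connected B) {v} (v∈S : v ∈ S) where

    -- A bound on the distance of every vertex to S.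
    horizon : ℕ
    horizon = ∑[ x < n ] walkLength (conn x v)

    module Layers (x : Fin n) =
      Monotone (λ k → near? k x) inj₁

    near-horizon : ∀ x → Near horizon x
    near-horizon x = Layers.P-mono x (term≤∑ (λ y → walkLength (conn y v)) x)
                                     (walk-near (conn x v) v∈S)

    dist : Fin n → ℕ
    dist x = misses (λ k → near? k x) horizon

    dist-descends : ∀ {x} → x ∉ S → ∃ λ u → Adj B x u × dist u < dist x
    dist-descends {x} x∉S with Layers.switch x x∉S (near-horizon x)
    ... | j , ¬near , inj₁ near              = contradiction near ¬near
    ... | j , ¬near , inj₂ (u , x~u , nearU) =
          u , x~u , ℕP.≤-<-trans (Layers.misses≤hit u nearU horizon)
                                 (Layers.miss<misses x ¬near (near-horizon x))

    dist-invariant : ∀ {σ τ} → Symmetry σ → Symmetry τ → (∀ x → τ (σ x) ≡ x) →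
                     ∀ x → dist (σ x) ≡ dist x
    dist-invariant {σ} {τ} sym-σ sym-τ τσ≡id x =
      misses-cong (λ k → near? k (σ x)) (λ k → near? k x)
        (λ k → mk⇔ (λ near → subst (Near k) (τσ≡id x) (near-transport sym-τ k near))
                   (near-transport sym-σ k))
        horizon

module Pivots {c ℓ} {G : Group c ℓ} {n} {B : Graph n} (α : Action G B) where
  open Group G using (ε; _⁻¹; inverseˡ)
  open Edges B

  act-Adj : ∀ g {x y} → Adj B x y → Adj B (act α g x) (act α g y)
  act-Adj g {x} {y} = subst T (sym (act-adj α g x y))

  act⁻¹-act : ∀ g x → act α (g ⁻¹) (act α g x) ≡ x
  act⁻¹-act g x = trans (sym (act-∙ α (g ⁻¹) g x)) (trans (act-cong α (inverseˡ g) x) (act-ε α x))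

  module _ (h : Fin n → ℕ) (h-inv : ∀ g y → h (act α g y) ≡ h y) where

    uniqueLower : ∀ {x u y} → down h x < 2 → Lower h x u → Lower h x y → y ≡ u
    uniqueLower {x} {u} {y} few lowU lowY with y ≟ u
    ... | yes y≡u = y≡u
    ... | no  y≢u = contradiction
          (subst₂ (λ a b → a ⊕ b ≤ₙ down h x) (𝟙-yes (lower? h x y) lowY) (𝟙-yes (lower? h x u) lowU)
                  (twoTerms≤∑ (λ w → 𝟙 (lower? h x w)) y≢u))
          (ℕP.<⇒≱ few)

    stab-lower : ∀ {x u y} → Lower h x u → StabOrbit α x u y → Lower h x y
    stab-lower {x} {u} (x~u , u<x) (g , gx≡x , gu≡y) =
      subst₂ (Adj B) gx≡x gu≡y (act-Adj g x~u) ,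
      subst (_< h x) (trans (sym (h-inv g u)) (cong h gu≡y)) u<x

    -- A pivot with a lower neighbour has at least two of them: otherwise
    -- the stabiliser orbit of that neighbour would be a singleton.
    pivot⇒twoLower : ∀ {x u} → Pivot α x → Lower h x u → 2 ≤ₙ down h x
    pivot⇒twoLower {x} {u} pivot lowU with 2 ≤? down h x
    ... | yes two = two
    ... | no  few = contradiction (subst (2 ∣_) (∣⁅x⁆∣≡1 u) (pivot u (proj₁ lowU) ⁅ u ⁆ singleton))
                                  (λ 2∣1 → contradiction (∣1⇒≡1 2∣1) λ ())
      where
      singleton : Represents ⁅ u ⁆ (StabOrbit α x u)
      singleton y = mk⇔
        (λ y∈u → ε , act-ε α x , trans (act-ε α u) (sym (x∈⁅y⁆⇒x≡y u y∈u)))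
        (λ orb → subst (_∈ ⁅ u ⁆) (sym (uniqueLower (ℕP.≰⇒> few) lowU (stab-lower lowU orb))) (x∈⁅x⁆ u))

module OrbitDistance {c ℓ} {G : Group c ℓ} {n} {B : Graph n} (α : Action G B)
                     (conn : Connected B) (v : Fin n)
                     (Gv : Subset n) (repG : Represents Gv (InOrbit α v)) where
  open Group G using (ε; _∙_; _⁻¹)
  open Edges B
  open Distance B Gv
  open Pivots α

  v∈Gv : v ∈ Gv
  v∈Gv = Equivalence.from (repG v) (ε , act-ε α v)

  act-symmetry : ∀ g → Symmetry (act α g)
  act-symmetry g = record
    { σ-adj = act-Adj g
    ; σ-S   = λ {x} x∈Gv → let (k , kv≡x) = Equivalence.to (repG x) x∈Gv in
        Equivalence.from (repG _) (g ∙ k , trans (act-∙ α g k v) (cong (act α g) kv≡x)) }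

  h : Fin n → ℕ
  h = dist conn v∈Gv

  h-inv : ∀ g y → h (act α g y) ≡ h y
  h-inv g = dist-invariant conn v∈Gv (act-symmetry g) (act-symmetry (g ⁻¹)) (act⁻¹-act g)

  pointBound : (W : Subset n) → Represents W (λ x → Pivot α x × ¬ InOrbit α v x) →
               ∀ x → 𝟙 (x ∈? W) ⊕ 1 ≤ₙ down h x ⊕ 𝟙 (x ∈? Gv)
  pointBound W repW x with x ∈? Gv | x ∈? W
  ... | yes x∈Gv | yes x∈W = contradiction (Equivalence.to (repG x) x∈Gv) (proj₂ (Equivalence.to (repW x) x∈W))
  ... | yes _    | no  _   = ℕP.m≤n+m 1 (down h x)
  ... | no  x∉Gv | no  _   = let (u , x~u , u<x) = dist-descends conn v∈Gv x∉Gv in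
        ℕP.≤-trans (ℕP.≤-reflexive (sym (𝟙-yes (lower? h x u) (x~u , u<x))))
                   (ℕP.≤-trans (term≤∑ (λ w → 𝟙 (lower? h x w)) u) (ℕP.m≤m+n _ 0))
  ... | no  x∉Gv | yes x∈W = let (u , x~u , u<x) = dist-descends conn v∈Gv x∉Gv in
        ℕP.≤-trans (pivot⇒twoLower h h-inv (proj₁ (Equivalence.to (repW x) x∈W)) (x~u , u<x))
                   (ℕP.m≤m+n _ 0)

bettiBound : ∀ w m e g → w ⊕ m ≤ₙ e ⊕ g →
             + w ≤ ((((+ e) - (+ m)) + + 1) + + g) - + 1
bettiBound w m e g w+m≤e+g = subst₂ _≤_
  (trans (cong (_- + m) (ℤP.pos-+ w m)) (cancel (+ w) (+ m)))
  (trans (cong (_- + m) (ℤP.pos-+ e g)) (rearrange (+ e) (+ m) (+ g)))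
  (ℤP.+-monoˡ-≤ (ℤ.- + m) (ℤ.+≤+ w+m≤e+g))
  where
  cancel : ∀ (a b : ℤ.ℤ) → (a + b) - b ≡ a
  cancel = solve-∀
  rearrange : ∀ (a b c : ℤ.ℤ) → (a + c) - b ≡ ((a - b) + + 1 + c) - + 1
  rearrange = solve-∀

lemma3p3 : ∀ {c ℓ} (G : Group c ℓ) {n : ℕ} (B : Graph n) (α : Action G B) →
    Connected B → (v : Fin n) →
    (WmGv Gv : Subset n) →
    Represents WmGv (λ x → Pivot α x × ¬ InOrbit α v x) →
    Represents Gv (InOrbit α v) →
    + ∣ WmGv ∣ ≤ (betti B + + ∣ Gv ∣) - + 1
lemma3p3 G {n} B α conn v W Gv repW repG =
  bettiBound (∣ W ∣) n (numEdges B) (∣ Gv ∣) (begin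
    ∣ W ∣ ⊕ n                                   ≡⟨ cong₂ _⊕_ (∣S∣≡∑ W) (sym (∑-ones n)) ⟩
    ∑[ x < n ] 𝟙 (x ∈? W) ⊕ ∑[ x < n ] 1          ≡⟨ ∑-distrib-+ (λ x → 𝟙 (x ∈? W)) (λ _ → 1) ⟨
    ∑[ x < n ] (𝟙 (x ∈? W) ⊕ 1)                  ≤⟨ ∑-mono (pointBound W repW) ⟩
    ∑[ x < n ] (down h x ⊕ 𝟙 (x ∈? Gv))          ≡⟨ ∑-distrib-+ (down h) (λ x → 𝟙 (x ∈? Gv)) ⟩
    ∑[ x < n ] down h x ⊕ ∑[ x < n ] 𝟙 (x ∈? Gv)  ≤⟨ ℕP.+-mono-≤ (∑down≤numEdges h) (ℕP.≤-reflexive (sym (∣S∣≡∑ Gv))) ⟩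
    numEdges B ⊕ ∣ Gv ∣                          ∎)
  where
  open ℕP.≤-Reasoning
  open Edges B
  open OrbitDistance α conn v Gv repG
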